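{- For each even integer $n\ge 8$, the Kurepa determinant $K_n$ is not divisible by $n$, i.e. $K_n\not\equiv 0\pmod n$.
   Context: For an integer $N\ge 7$ let $m=N-4$ and let $M_N=(a_{ij})_{1\le i,j\le m}$ be the integer matrix with entries: row $1$: $a_{1j}=1$ for $1\le j\le m-1$ and $a_{1m}=3$; for $2\le i\le m-1$: $a_{ij}=0$ if $j<i-2$, $a_{i,i-2}=1$ (when $i\ge 3$), $a_{i,i-1}=i+1$, $a_{ij}=1$ for $i\le j\le m-1$, and $a_{im}=2$; last row $m$: $a_{mj}=0$ for $j\le m-2$, $a_{m,m-1}=1$, $a_{mm}=-4$. (E.g. for $N=7$: rows $(1,1,3),(3,1,2),(0,1,-4)$.) The Kurepa determinant is $K_N=\det M_N$. -}

module Defs where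

open import Data.Bool using (Bool; true; false; if_then_else_)
open import Data.Nat as ℕ using (ℕ; zero; suc; _≡ᵇ_; _<ᵇ_; _∸_)
open import Data.Fin using (Fin; zero; suc; toℕ; punchIn)
open import Data.Integer using (ℤ; +_; -_; _+_; _*_; -[1+_])

Matrix : ℕ → Set
Matrix n = Fin n → Fin n → ℤ

sign : ℕ → ℤ
sign zero = + 1
sign (suc k) = - sign k

sumFin : (n : ℕ) → (Fin n → ℤ) → ℤ
sumFin zero f = + 0
sumFin (suc n) f = f zero + sumFin n (λ j → f (suc j))

det : (n : ℕ) → Matrix n → ℤ
det zero A = + 1
det (suc n) A =
  sumFin (suc n) (λ j → sign (toℕ j) * (A zero j * det n (λ r c → A (suc r) (punchIn j c))))

-- Entry a_{ij} of M_N, with m = N - 4, indices 1-based (1 ≤ i, j ≤ m).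
kurepaEntry : (m i j : ℕ) → ℤ
kurepaEntry m i j =
  if i ≡ᵇ 1 then (if j ≡ᵇ m then + 3 else + 1)
  else if i ≡ᵇ m then
    (if j ≡ᵇ m then -[1+ 3 ] else if suc j ≡ᵇ m then + 1 else + 0)
  else
    (if j ≡ᵇ m then + 2
     else if suc j ≡ᵇ i then + (suc i)
     else if suc (suc j) ≡ᵇ i then + 1
     else if j <ᵇ i then + 0
     else + 1)

kurepaMatrix : (N : ℕ) → Matrix (N ∸ 4)
kurepaMatrix N i j = kurepaEntry (N ∸ 4) (suc (toℕ i)) (suc (toℕ j))

K : ℕ → ℤ
K N = det (N ∸ 4) (kurepaMatrix N)

module Submission where

-- The proof is a parity argument: K N is odd for every N ≥ 7, so no even
-- number divides it.  To see that K N is odd we compute det M_N over the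
-- two-element field 𝔽₂ (the type 'Parity').
--
--  1. Finite sums and a first-row determinant det₂ over 𝔽₂; reduction
--     modulo 2 commutes with the integer determinant of 'Defs'.
--  2. Over 𝔽₂ a matrix with two equal leading rows has determinant 0, hence
--     adding row 1 to row 0 does not change det₂; if the new row 0 is a
--     standard basis vector e_c, the determinant is that of the minor
--     obtained by deleting row 0 and column c ('det₂-eliminate').
--  3. Modulo 2, the first two rows of M_N add up to e_m; eliminating
--     leaves a "staircase" matrix (row 0 all ones, row t+1 of the shape
--     0 … 0 a b 1 … 1).  Two further eliminations shrink a staircase of
--     the relevant shape by two, so its determinant is 1 by induction.
--  4. If n is even and n ∣ K n, then K n is even, contradicting step 3.

open import Defs
open import Data.Nat using (ℕ; _≤_; _%_)
open import Data.Integer using (+_)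
open import Data.Integer.Divisibility using (_∣_)
open import Relation.Binary.PropositionalEquality using (_≡_)
open import Relation.Nullary using (¬_)

open import Data.Bool using (true; false; if_then_else_)
open import Data.Bool.Properties using (if-eta; T-≡)
open import Data.Nat.Base as ℕ using (zero; suc; _≡ᵇ_; _<ᵇ_; _<_; _∸_; s≤s; parity)
open import Data.Nat.Properties using (≡ᵇ⇒≡; <⇒≤; m+[n∸m]≡n; +-suc)
open import Data.Nat.Divisibility using (divides; ∣-trans; m%n≡0⇒n∣m)
open import Function.Bundles using (Equivalence)
open import Data.Fin.Base using (Fin; zero; suc; toℕ; punchIn; fromℕ)
open import Data.Fin.Properties using (toℕ-fromℕ; toℕ<n)
open import Data.Integer.Base as ℤ using (ℤ; -[1+_]; ∣_∣; _⊖_)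
open import Data.Integer.Properties using (∣-i∣≡∣i∣; abs-*; [1+m]⊖[1+n]≡m⊖n)
open import Data.Parity.Base using (Parity; 0ℙ; 1ℙ; _*_) renaming (_+_ to infixl 6 _⊕_)
open import Data.Parity.Properties
  using ( p≢p⁻¹; p+p≡0ℙ; +-identityʳ; +-comm; +-assoc; *-zeroʳ; *-distribˡ-+; *-distribʳ-+
        ; +-homo-+; *-homo-*; +-commutativeSemigroup; *-commutativeSemigroup)
open import Algebra.Properties.CommutativeSemigroup +-commutativeSemigroup
  using (interchange)
open import Algebra.Properties.CommutativeSemigroup *-commutativeSemigroup
  using (x∙yz≈y∙xz)
open import Relation.Binary.PropositionalEquality
  using (refl; sym; trans; cong; cong₂; module ≡-Reasoning)
open ≡-Reasoning

∑ : (n : ℕ) → (Fin n → Parity) → Parity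
∑ zero    f = 0ℙ
∑ (suc n) f = f zero ⊕ ∑ n (λ j → f (suc j))

∑-cong : ∀ n {f g : Fin n → Parity} → (∀ j → f j ≡ g j) → ∑ n f ≡ ∑ n g
∑-cong zero    f≡g = refl
∑-cong (suc n) f≡g = cong₂ _⊕_ (f≡g zero) (∑-cong n (λ j → f≡g (suc j)))

∑-⊕ : ∀ n (f g : Fin n → Parity) → ∑ n (λ j → f j ⊕ g j) ≡ ∑ n f ⊕ ∑ n g
∑-⊕ zero    f g = refl
∑-⊕ (suc n) f g =
  trans (cong ((f zero ⊕ g zero) ⊕_) (∑-⊕ n (λ j → f (suc j)) (λ j → g (suc j))))
        (interchange (f zero) (g zero) _ _)

*-∑ : ∀ n a (f : Fin n → Parity) → a * ∑ n f ≡ ∑ n (λ j → a * f j)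
*-∑ zero    a f = *-zeroʳ a
*-∑ (suc n) a f =
  trans (*-distribˡ-+ a (f zero) _) (cong ((a * f zero) ⊕_) (*-∑ n a (λ j → f (suc j))))

∑-zero : ∀ n → ∑ n (λ _ → 0ℙ) ≡ 0ℙ
∑-zero zero    = refl
∑-zero (suc n) = ∑-zero n

-- The standard basis vector e_c of 𝔽₂ⁿ (compared through 'toℕ', which makes
-- it compute well on the concrete matrices below).
basis : ∀ {n} → Fin n → Fin n → Parity
basis c j = if toℕ j ≡ᵇ toℕ c then 1ℙ else 0ℙ

∑-basis : ∀ n (c : Fin n) (f : Fin n → Parity) → ∑ n (λ j → basis c j * f j) ≡ f c
∑-basis (suc n) zero    f = trans (cong (f zero ⊕_) (∑-zero n)) (+-identityʳ (f zero))
∑-basis (suc n) (suc c) f = ∑-basis n c (λ j → f (suc j))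

-- Over 𝔽₂ a symmetric function summed over all ordered pairs (j , k) with
-- j ≢ k vanishes, since each unordered pair is counted twice.  The pairs are
-- enumerated as (j , punchIn j c).
∑-offDiagonal-symmetric :
  ∀ n (g : Fin (suc n) → Fin (suc n) → Parity) → (∀ x y → g x y ≡ g y x) →
  ∑ (suc n) (λ j → ∑ n (λ c → g j (punchIn j c))) ≡ 0ℙ
∑-offDiagonal-symmetric zero    g sym-g = refl
∑-offDiagonal-symmetric (suc n) g sym-g = begin
  X ⊕ ∑ (suc n) (λ j → g (suc j) zero ⊕ ∑ n (λ c → g′ j (punchIn j c)))
    ≡⟨ cong (X ⊕_) (∑-⊕ (suc n) (λ j → g (suc j) zero) (λ j → ∑ n (λ c → g′ j (punchIn j c)))) ⟩
  X ⊕ (∑ (suc n) (λ j → g (suc j) zero) ⊕ Y)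
    ≡⟨ cong (λ z → X ⊕ (z ⊕ Y)) (∑-cong (suc n) (λ j → sym-g (suc j) zero)) ⟩
  X ⊕ (X ⊕ Y)
    ≡⟨ sym (+-assoc X X Y) ⟩
  X ⊕ X ⊕ Y
    ≡⟨ cong (_⊕ Y) (p+p≡0ℙ X) ⟩
  Y
    ≡⟨ ∑-offDiagonal-symmetric n g′ (λ x y → sym-g (suc x) (suc y)) ⟩
  0ℙ ∎
  where
  g′ : Fin (suc n) → Fin (suc n) → Parity
  g′ x y = g (suc x) (suc y)

  X Y : Parity
  X = ∑ (suc n) (λ c → g zero (suc c))
  Y = ∑ (suc n) (λ j → ∑ n (λ c → g′ j (punchIn j c)))

Matrix₂ : ℕ → Set
Matrix₂ n = Fin n → Fin n → Parity

minor : ∀ {n} → Fin (suc n) → Matrix₂ (suc n) → Matrix₂ n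
minor j A r c = A (suc r) (punchIn j c)

-- Laplace expansion along the first row; signs disappear in characteristic 2.
det₂ : (n : ℕ) → Matrix₂ n → Parity
det₂ zero    A = 1ℙ
det₂ (suc n) A = ∑ (suc n) (λ j → A zero j * det₂ n (minor j A))

det₂-cong : ∀ n {A B : Matrix₂ n} → (∀ i j → A i j ≡ B i j) → det₂ n A ≡ det₂ n B
det₂-cong zero    A≡B = refl
det₂-cong (suc n) A≡B =
  ∑-cong (suc n) (λ j → cong₂ _*_ (A≡B zero j)
                                  (det₂-cong n (λ r c → A≡B (suc r) (punchIn j c))))

-- The embedding of Fin n into Fin (n + 2) avoiding the two points x and y
-- (for x ≢ y; the value for x ≡ y is irrelevant).  It indexes the columns
-- of a second-order minor independently of the order of deletion.
punchIn₂ : ∀ {n} → Fin (suc (suc n)) → Fin (suc (suc n)) → Fin n → Fin (suc (suc n))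
punchIn₂ zero    zero    c = suc (suc c)
punchIn₂ zero    (suc y) c = suc (punchIn y c)
punchIn₂ (suc x) zero    c = suc (punchIn x c)
punchIn₂ {suc n} (suc x) (suc y) zero    = zero
punchIn₂ {suc n} (suc x) (suc y) (suc c) = suc (punchIn₂ x y c)

punchIn₂-sym : ∀ {n} x y (c : Fin n) → punchIn₂ x y c ≡ punchIn₂ y x c
punchIn₂-sym zero    zero    c = refl
punchIn₂-sym zero    (suc y) c = refl
punchIn₂-sym (suc x) zero    c = refl
punchIn₂-sym {suc n} (suc x) (suc y) zero    = refl
punchIn₂-sym {suc n} (suc x) (suc y) (suc c) = cong suc (punchIn₂-sym x y c)

punchIn₂-punchIn : ∀ {n} (j : Fin (suc (suc n))) (c : Fin (suc n)) (c′ : Fin n) →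
                   punchIn₂ j (punchIn j c) c′ ≡ punchIn j (punchIn c c′)
punchIn₂-punchIn zero    c       c′ = refl
punchIn₂-punchIn (suc j) zero    c′ = refl
punchIn₂-punchIn {suc n} (suc j) (suc c) zero     = refl
punchIn₂-punchIn {suc n} (suc j) (suc c) (suc c′) = cong suc (punchIn₂-punchIn j c c′)

-- A matrix whose rows 0 and 1 coincide has determinant 0.  Expanding along
-- both rows writes det₂ A as a sum over ordered pairs of distinct columns of
-- a term symmetric in the pair.
det₂-repeatedRow : ∀ n (A : Matrix₂ (suc (suc n))) →
                   (∀ j → A zero j ≡ A (suc zero) j) → det₂ (suc (suc n)) A ≡ 0ℙ
det₂-repeatedRow n A row₀≡row₁ = begin
  det₂ (suc (suc n)) A
    ≡⟨⟩
  ∑ (suc (suc n)) (λ j → A zero j * ∑ (suc n) (expandRow₁ j))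
    ≡⟨ ∑-cong (suc (suc n)) (λ j → trans (*-∑ (suc n) (A zero j) (expandRow₁ j))
                                         (∑-cong (suc n) (pairTerm j))) ⟩
  ∑ (suc (suc n)) (λ j → ∑ (suc n) (λ c → g j (punchIn j c)))
    ≡⟨ ∑-offDiagonal-symmetric (suc n) g g-sym ⟩
  0ℙ ∎
  where
  expandRow₁ : Fin (suc (suc n)) → Fin (suc n) → Parity
  expandRow₁ j c = A (suc zero) (punchIn j c) * det₂ n (minor c (minor j A))

  D : Fin (suc (suc n)) → Fin (suc (suc n)) → Parity
  D x y = det₂ n (λ r c → A (suc (suc r)) (punchIn₂ x y c))

  g : Fin (suc (suc n)) → Fin (suc (suc n)) → Parity
  g x y = A zero x * (A zero y * D x y)

  g-sym : ∀ x y → g x y ≡ g y x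
  g-sym x y = trans (x∙yz≈y∙xz (A zero x) (A zero y) (D x y))
    (cong (λ z → A zero y * (A zero x * z))
          (det₂-cong n (λ r c → cong (A (suc (suc r))) (punchIn₂-sym x y c))))

  pairTerm : ∀ j c → A zero j * expandRow₁ j c ≡ g j (punchIn j c)
  pairTerm j c = cong₂ (λ u v → A zero j * (u * v)) (sym (row₀≡row₁ (punchIn j c)))
    (det₂-cong n (λ r c′ → cong (A (suc (suc r))) (sym (punchIn₂-punchIn j c c′))))

addRow₁ : ∀ {n} → Matrix₂ (suc (suc n)) → Matrix₂ (suc (suc n))
addRow₁ A zero    j = A zero j ⊕ A (suc zero) j
addRow₁ A (suc i) j = A (suc i) j

copyRow₁ : ∀ {n} → Matrix₂ (suc (suc n)) → Matrix₂ (suc (suc n))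
copyRow₁ A zero    j = A (suc zero) j
copyRow₁ A (suc i) j = A (suc i) j

-- Adding row 1 to row 0 preserves det₂: by linearity in row 0 the change is
-- det₂ (copyRow₁ A), which vanishes.
det₂-addRow₁ : ∀ n (A : Matrix₂ (suc (suc n))) →
               det₂ (suc (suc n)) (addRow₁ A) ≡ det₂ (suc (suc n)) A
det₂-addRow₁ n A = begin
  ∑ (suc (suc n)) (λ j → (A zero j ⊕ A (suc zero) j) * P j)
    ≡⟨ ∑-cong (suc (suc n)) (λ j → *-distribʳ-+ (P j) (A zero j) (A (suc zero) j)) ⟩
  ∑ (suc (suc n)) (λ j → A zero j * P j ⊕ A (suc zero) j * P j)
    ≡⟨ ∑-⊕ (suc (suc n)) (λ j → A zero j * P j) (λ j → A (suc zero) j * P j) ⟩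
  det₂ (suc (suc n)) A ⊕ det₂ (suc (suc n)) (copyRow₁ A)
    ≡⟨ cong (det₂ (suc (suc n)) A ⊕_) (det₂-repeatedRow n (copyRow₁ A) (λ j → refl)) ⟩
  det₂ (suc (suc n)) A ⊕ 0ℙ
    ≡⟨ +-identityʳ _ ⟩
  det₂ (suc (suc n)) A ∎
  where
  P : Fin (suc (suc n)) → Parity
  P j = det₂ (suc n) (minor j A)

det₂-basisRow : ∀ n (A : Matrix₂ (suc n)) (c : Fin (suc n)) →
                (∀ j → A zero j ≡ basis c j) → det₂ (suc n) A ≡ det₂ n (minor c A)
det₂-basisRow n A c row₀≡e =
  trans (∑-cong (suc n) (λ j → cong (_* det₂ n (minor j A)) (row₀≡e j)))
        (∑-basis (suc n) c (λ j → det₂ n (minor j A)))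

det₂-eliminate : ∀ n (A : Matrix₂ (suc (suc n))) (c : Fin (suc (suc n))) →
                 (∀ j → A zero j ⊕ A (suc zero) j ≡ basis c j) →
                 det₂ (suc (suc n)) A ≡ det₂ (suc n) (minor c A)
det₂-eliminate n A c rows≡e =
  trans (sym (det₂-addRow₁ n A)) (det₂-basisRow (suc n) (addRow₁ A) c rows≡e)

parityℤ : ℤ → Parity
parityℤ a = parity ∣ a ∣

-- parityℤ is a ring homomorphism ℤ → 𝔽₂ that sends every sign (-1)^k to 1,
-- hence preserves the first-row expansions of 'sumFin' and 'det'.
parity-suc⊕suc : ∀ m n → parity (suc m) ⊕ parity (suc n) ≡ parity m ⊕ parity n
parity-suc⊕suc m n = begin
  parity (suc m) ⊕ parity (suc n) ≡⟨ sym (+-homo-+ (suc m) (suc n)) ⟩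
  parity (suc m ℕ.+ suc n)        ≡⟨ cong parity (+-suc (suc m) n) ⟩
  parity (m ℕ.+ n)                ≡⟨ +-homo-+ m n ⟩
  parity m ⊕ parity n             ∎

parityℤ-⊖ : ∀ m n → parityℤ (m ⊖ n) ≡ parity m ⊕ parity n
parityℤ-⊖ m       zero    = sym (+-identityʳ (parity m))
parityℤ-⊖ zero    (suc n) = refl
parityℤ-⊖ (suc m) (suc n) = begin
  parityℤ (suc m ⊖ suc n)         ≡⟨ cong parityℤ ([1+m]⊖[1+n]≡m⊖n m n) ⟩
  parityℤ (m ⊖ n)                 ≡⟨ parityℤ-⊖ m n ⟩
  parity m ⊕ parity n             ≡⟨ sym (parity-suc⊕suc m n) ⟩
  parity (suc m) ⊕ parity (suc n) ∎

parityℤ-+ : ∀ a b → parityℤ (a ℤ.+ b) ≡ parityℤ a ⊕ parityℤ b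
parityℤ-+ (+ m)    (+ n)    = +-homo-+ m n
parityℤ-+ (+ m)    -[1+ n ] = parityℤ-⊖ m (suc n)
parityℤ-+ -[1+ m ] (+ n)    = trans (parityℤ-⊖ n (suc m)) (+-comm (parity n) _)
parityℤ-+ -[1+ m ] -[1+ n ] = trans (+-homo-+ m n) (sym (parity-suc⊕suc m n))

parityℤ-* : ∀ a b → parityℤ (a ℤ.* b) ≡ parityℤ a * parityℤ b
parityℤ-* a b = trans (cong parity (abs-* a b)) (*-homo-* ∣ a ∣ ∣ b ∣)

parityℤ-sign : ∀ k → parityℤ (sign k) ≡ 1ℙ
parityℤ-sign zero    = refl
parityℤ-sign (suc k) = trans (cong parity (∣-i∣≡∣i∣ (sign k))) (parityℤ-sign k)

parityℤ-sumFin : ∀ n (f : Fin n → ℤ) → parityℤ (sumFin n f) ≡ ∑ n (λ j → parityℤ (f j))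
parityℤ-sumFin zero    f = refl
parityℤ-sumFin (suc n) f =
  trans (parityℤ-+ (f zero) _) (cong (parityℤ (f zero) ⊕_) (parityℤ-sumFin n (λ j → f (suc j))))

parityℤ-det : ∀ n (A : Matrix n) → parityℤ (det n A) ≡ det₂ n (λ i j → parityℤ (A i j))
parityℤ-det zero    A = refl
parityℤ-det (suc n) A =
  trans (parityℤ-sumFin (suc n) (λ j → sign (toℕ j) ℤ.* (A zero j ℤ.* det n (M j))))
        (∑-cong (suc n) term)
  where
  M : Fin (suc n) → Matrix n
  M j r c = A (suc r) (punchIn j c)

  term : ∀ j → parityℤ (sign (toℕ j) ℤ.* (A zero j ℤ.* det n (M j)))
             ≡ parityℤ (A zero j) * det₂ n (λ r c → parityℤ (M j r c))
  term j = begin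
    parityℤ (sign (toℕ j) ℤ.* (A zero j ℤ.* det n (M j)))
      ≡⟨ parityℤ-* (sign (toℕ j)) _ ⟩
    parityℤ (sign (toℕ j)) * parityℤ (A zero j ℤ.* det n (M j))
      ≡⟨ cong (_* parityℤ (A zero j ℤ.* det n (M j))) (parityℤ-sign (toℕ j)) ⟩
    parityℤ (A zero j ℤ.* det n (M j))
      ≡⟨ parityℤ-* (A zero j) (det n (M j)) ⟩
    parityℤ (A zero j) * parityℤ (det n (M j))
      ≡⟨ cong (parityℤ (A zero j) *_) (parityℤ-det n (M j)) ⟩
    parityℤ (A zero j) * det₂ n (λ r c → parityℤ (M j r c)) ∎

parityℤ-even-multiple : ∀ n a → n % 2 ≡ 0 → (+ n) ∣ a → parityℤ a ≡ 0ℙ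
parityℤ-even-multiple n a n-even n∣a with ∣-trans (m%n≡0⇒n∣m n 2 n-even) n∣a
... | divides q ∣a∣≡q*2 = trans (cong parity ∣a∣≡q*2) (trans (*-homo-* q 2) (*-zeroʳ (parity q)))

-- Staircase matrices: the shape to which elimination reduces M_N modulo 2.
-- The row (0, …, 0, a, b, 1, 1, …) whose entry a sits in column t.
stairRow : Parity → Parity → ℕ → ℕ → Parity
stairRow a b zero    zero          = a
stairRow a b zero    (suc zero)    = b
stairRow a b zero    (suc (suc c)) = 1ℙ
stairRow a b (suc t) zero          = 0ℙ
stairRow a b (suc t) (suc c)       = stairRow a b t c

stairEntry : (ℕ → Parity) → (ℕ → Parity) → ℕ → ℕ → Parity
stairEntry s d zero    c = 1ℙ
stairEntry s d (suc t) c = stairRow (s t) (d t) t c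

staircase : (k : ℕ) → (ℕ → Parity) → (ℕ → Parity) → Matrix₂ k
staircase k s d i j = stairEntry s d (toℕ i) (toℕ j)

-- If row 1 is (0, 1, 1, …), rows 0 and 1 add up to e₀; deleting row 0 and
-- column 0 leaves the staircase of the remaining rows.
staircase-dropColumn₀ :
  ∀ k s d → s 0 ≡ 0ℙ → d 0 ≡ 1ℙ →
  det₂ (suc (suc k)) (staircase (suc (suc k)) s d)
    ≡ det₂ (suc k) (staircase (suc k) (λ t → s (suc t)) (λ t → d (suc t)))
staircase-dropColumn₀ k s d s₀≡0 d₀≡1 =
  trans (det₂-eliminate k (staircase (suc (suc k)) s d) zero rows≡e)
        (det₂-cong (suc k) (λ r c → entry (toℕ r) (toℕ c)))
  where
  rows≡e : ∀ j → 1ℙ ⊕ stairRow (s 0) (d 0) 0 (toℕ j) ≡ basis zero j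
  rows≡e zero          = cong (1ℙ ⊕_) s₀≡0
  rows≡e (suc zero)    = cong (1ℙ ⊕_) d₀≡1
  rows≡e (suc (suc j)) = refl

  entry : ∀ r c → stairEntry s d (suc r) (suc c)
                ≡ stairEntry (λ t → s (suc t)) (λ t → d (suc t)) r c
  entry zero    zero    = d₀≡1
  entry zero    (suc c) = refl
  entry (suc r) c       = refl

-- Column c of the minor without column 1 is column skipOne c of the matrix.
skipOne : ℕ → ℕ
skipOne zero    = zero
skipOne (suc c) = suc (suc c)

toℕ-punchIn₁ : ∀ {n} (c : Fin (suc n)) → toℕ (punchIn (suc zero) c) ≡ skipOne (toℕ c)
toℕ-punchIn₁ zero    = refl
toℕ-punchIn₁ (suc c) = refl

-- Sub-diagonal data after deleting column 1: the new row 1 (formerly row 2)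
-- starts with its zero, later rows keep their data.
dropSub : (ℕ → Parity) → ℕ → Parity
dropSub s zero    = 0ℙ
dropSub s (suc t) = s (suc (suc t))

-- If row 1 is (1, 0, 1, …), rows 0 and 1 add up to e₁; deleting row 0 and
-- column 1 again leaves a staircase.
staircase-dropColumn₁ :
  ∀ k s d → s 0 ≡ 1ℙ → d 0 ≡ 0ℙ →
  det₂ (suc (suc k)) (staircase (suc (suc k)) s d)
    ≡ det₂ (suc k) (staircase (suc k) (dropSub s) (λ t → d (suc t)))
staircase-dropColumn₁ k s d s₀≡1 d₀≡0 =
  trans (det₂-eliminate k (staircase (suc (suc k)) s d) (suc zero) rows≡e)
        (det₂-cong (suc k) λ r c → trans (cong (stairEntry s d (suc (toℕ r))) (toℕ-punchIn₁ c))
                                         (entry (toℕ r) (toℕ c)))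
  where
  rows≡e : ∀ j → 1ℙ ⊕ stairRow (s 0) (d 0) 0 (toℕ j) ≡ basis (suc zero) j
  rows≡e zero          = cong (1ℙ ⊕_) s₀≡1
  rows≡e (suc zero)    = cong (1ℙ ⊕_) d₀≡0
  rows≡e (suc (suc j)) = refl

  entry : ∀ r c → stairEntry s d (suc r) (skipOne c)
                ≡ stairEntry (dropSub s) (λ t → d (suc t)) r c
  entry zero          zero          = s₀≡1
  entry zero          (suc c)       = refl
  entry (suc zero)    zero          = refl
  entry (suc zero)    (suc zero)    = refl
  entry (suc zero)    (suc (suc c)) = refl
  entry (suc (suc r)) zero          = refl
  entry (suc (suc r)) (suc c)       = refl

-- Deleting the first row and the last column of M_N modulo 2 leaves a
-- staircase of size k = N - 5 whose row t+1 (row t+3 of M_N) carries the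
-- entries a_{i,i-2} ≡ 1 and a_{i,i-1} = i+1 ≡ t, except the last row,
-- which is (0, …, 0, 1).
kurepaSub₂ : ℕ → ℕ → Parity
kurepaSub₂ k t = if suc (suc t) ≡ᵇ k then 0ℙ else 1ℙ

kurepaDiag₂ : ℕ → ℕ → Parity
kurepaDiag₂ k t = if suc (suc t) ≡ᵇ k then 1ℙ else parity t

kurepaStaircase : (k : ℕ) → Matrix₂ k
kurepaStaircase k = staircase k (kurepaSub₂ k) (kurepaDiag₂ k)

-- Two eliminations turn this staircase of size k + 2 into the one of size k.
kurepaStaircase-det : ∀ k → det₂ (suc k) (kurepaStaircase (suc k)) ≡ 1ℙ
kurepaStaircase-det zero          = refl
kurepaStaircase-det (suc zero)    = staircase-dropColumn₀ 0 (kurepaSub₂ 2) (kurepaDiag₂ 2) refl refl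
kurepaStaircase-det (suc (suc k)) = begin
  det₂ (suc (suc (suc k))) (staircase (suc (suc (suc k))) s d)
    ≡⟨ staircase-dropColumn₁ (suc k) s d refl refl ⟩
  det₂ (suc (suc k)) (staircase (suc (suc k)) (dropSub s) (λ t → d (suc t)))
    ≡⟨ staircase-dropColumn₀ k (dropSub s) (λ t → d (suc t)) refl (if-eta (0 ≡ᵇ k)) ⟩
  det₂ (suc k) (kurepaStaircase (suc k))
    ≡⟨ kurepaStaircase-det k ⟩
  1ℙ ∎
  where
  s d : ℕ → Parity
  s = kurepaSub₂ (suc (suc (suc k)))
  d = kurepaDiag₂ (suc (suc (suc k)))

≡ᵇ-true⇒≡ : ∀ m n → (m ≡ᵇ n) ≡ true → m ≡ n
≡ᵇ-true⇒≡ m n m≡ᵇn = ≡ᵇ⇒≡ m n (Equivalence.from T-≡ m≡ᵇn)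

<⇒≡ᵇ-false : ∀ {c n} → c < n → (c ≡ᵇ n) ≡ false
<⇒≡ᵇ-false {zero}  {suc n} _         = refl
<⇒≡ᵇ-false {suc c} {suc n} (s≤s c<n) = <⇒≡ᵇ-false c<n

kurepa-firstRows : ∀ m′ j →
  parityℤ (kurepaEntry (suc (suc (suc m′))) 1 (suc j))
    ⊕ parityℤ (kurepaEntry (suc (suc (suc m′))) 2 (suc j))
  ≡ (if j ≡ᵇ suc (suc m′) then 1ℙ else 0ℙ)
kurepa-firstRows m′ zero    = refl
kurepa-firstRows m′ (suc j) with j ≡ᵇ suc m′
... | true  = refl
... | false = refl

kurepa-lastRow : ∀ m′ c → c < suc (suc m′) →
  parityℤ (if c ≡ᵇ suc m′ then + 1 else + 0) ≡ stairRow 0ℙ 1ℙ m′ c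
kurepa-lastRow zero       zero          _         = refl
kurepa-lastRow zero       (suc zero)    _         = refl
kurepa-lastRow zero       (suc (suc c)) (s≤s (s≤s ()))
kurepa-lastRow (suc m′)   zero          _         = refl
kurepa-lastRow (suc m′)   (suc c)       (s≤s c<m) = kurepa-lastRow m′ c c<m

kurepa-middleRow : ∀ t c v →
  parityℤ (if c ≡ᵇ suc t then v
           else if c ≡ᵇ t then + 1
           else if c <ᵇ suc (suc t) then + 0
           else + 1)
    ≡ stairRow 1ℙ (parityℤ v) t c
kurepa-middleRow zero    zero          v = refl
kurepa-middleRow zero    (suc zero)    v = refl
kurepa-middleRow zero    (suc (suc c)) v = refl
kurepa-middleRow (suc t) zero          v = refl
kurepa-middleRow (suc t) (suc c)       v = kurepa-middleRow t c v

kurepa-lowerRows : ∀ m′ r c → c < suc (suc m′) →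
  parityℤ (kurepaEntry (suc (suc (suc m′))) (suc (suc r)) (suc c))
    ≡ stairEntry (kurepaSub₂ (suc (suc m′))) (kurepaDiag₂ (suc (suc m′))) r c
kurepa-lowerRows m′ zero    zero    c<m = refl
kurepa-lowerRows m′ zero    (suc c) c<m rewrite <⇒≡ᵇ-false c<m = refl
kurepa-lowerRows m′ (suc t) c       c<m rewrite <⇒≡ᵇ-false c<m with t ≡ᵇ m′ in t≡ᵇm′
... | false = kurepa-middleRow t c (+ suc (suc (suc (suc t))))
... | true with refl ← ≡ᵇ-true⇒≡ t m′ t≡ᵇm′ = kurepa-lastRow m′ c c<m

toℕ-punchIn-last : ∀ {n} (c : Fin n) → toℕ (punchIn (fromℕ n) c) ≡ toℕ c
toℕ-punchIn-last zero    = refl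
toℕ-punchIn-last (suc c) = cong suc (toℕ-punchIn-last c)

K-odd : ∀ m′ → parityℤ (K (7 ℕ.+ m′)) ≡ 1ℙ
K-odd m′ = begin
  parityℤ (det m A)
    ≡⟨ parityℤ-det m A ⟩
  det₂ m B
    ≡⟨ det₂-eliminate (suc m′) B (fromℕ (suc (suc m′))) firstRows ⟩
  det₂ (suc (suc m′)) (minor (fromℕ (suc (suc m′))) B)
    ≡⟨ det₂-cong (suc (suc m′)) lowerRows ⟩
  det₂ (suc (suc m′)) (kurepaStaircase (suc (suc m′)))
    ≡⟨ kurepaStaircase-det (suc m′) ⟩
  1ℙ ∎
  where
  m = suc (suc (suc m′))
  A : Matrix m
  A = kurepaMatrix (7 ℕ.+ m′)
  B : Matrix₂ m
  B i j = parityℤ (A i j)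

  firstRows : ∀ j → B zero j ⊕ B (suc zero) j ≡ basis (fromℕ (suc (suc m′))) j
  firstRows j rewrite toℕ-fromℕ (suc (suc m′)) = kurepa-firstRows m′ (toℕ j)

  lowerRows : ∀ r c → minor (fromℕ (suc (suc m′))) B r c
                    ≡ kurepaStaircase (suc (suc m′)) r c
  lowerRows r c rewrite toℕ-punchIn-last c = kurepa-lowerRows m′ (toℕ r) (toℕ c) (toℕ<n c)

theorem2 : (n : ℕ) → 8 ≤ n → n % 2 ≡ 0 → ¬ ((+ n) ∣ K n)
theorem2 n 8≤n n-even n∣Kn = p≢p⁻¹ 1ℙ (begin
  1ℙ                          ≡⟨ sym (K-odd (n ∸ 7)) ⟩
  parityℤ (K (7 ℕ.+ (n ∸ 7))) ≡⟨ cong (λ N → parityℤ (K N)) (m+[n∸m]≡n (<⇒≤ 8≤n)) ⟩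
  parityℤ (K n)               ≡⟨ parityℤ-even-multiple n (K n) n-even n∣Kn ⟩
  0ℙ                          ∎)
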